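{- Let $D$ be a finite digraph (no loops, no parallel arcs, no anti-parallel arcs) and let $k\ge 1$ be an integer. For a total ordering of $V(D)$, call an arc $xy$ forward if $x$ precedes $y$ in the ordering and backward otherwise. Then the following are equivalent: (i) $\vec{\chi}(D)\le k$; (ii) there exists a total ordering of $V(D)$ such that $D$ contains no directed path on $k+1$ vertices all of whose arcs are backward.
   Context: The dichromatic number $\vec{\chi}(D)$ is the minimum integer $k$ such that $V(D)$ can be partitioned into $k$ sets each inducing an acyclic subdigraph (no directed cycle). A directed path is a sequence of pairwise distinct vertices $x_1,\dots,x_p$ with $x_ix_{i+1}\in A(D)$ for all $i<p$. -}

module Defs where

open import Data.Nat using (ℕ; zero; suc; _≤_; _<_; _∸_)
open import Data.Fin using (Fin; toℕ)
open import Data.Bool using (Bool; true; false; T)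
open import Data.Product using (Σ; ∃; _×_; _,_)
open import Data.Sum using (_⊎_)
open import Relation.Nullary using (¬_)
open import Relation.Binary.PropositionalEquality using (_≡_)
open import Function.Definitions using (Injective)
open import Data.Fin.Permutation using (Permutation′; _⟨$⟩ʳ_)

-- A finite digraph on vertex set Fin n, given by a Boolean adjacency
-- relation (so no parallel arcs), with no loops and no anti-parallel arcs.
record Digraph : Set where
  field
    n      : ℕ
    Arc    : Fin n → Fin n → Bool
    noLoop : ∀ x → Arc x x ≡ false
    noAnti : ∀ x y → T (Arc x y) → Arc y x ≡ false
open Digraph public

record CycleIn (D : Digraph) (S : Fin (n D) → Set) : Set where
  field
    len      : ℕ
    len≥2    : 2 ≤ len
    vtx      : Fin len → Fin (n D)
    distinct : Injective _≡_ _≡_ vtx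
    inS      : ∀ i → S (vtx i)
    arcs     : ∀ (i j : Fin len) →
               (toℕ j ≡ suc (toℕ i) ⊎ (toℕ i ≡ len ∸ 1 × toℕ j ≡ 0)) →
               T (Arc D (vtx i) (vtx j))

Acyclic : (D : Digraph) → (Fin (n D) → Set) → Set
Acyclic D S = ¬ CycleIn D S

-- dichromatic number ≤ k: V(D) partitioned into k (possibly empty) classes
-- (a map c : V → Fin k), each inducing an acyclic subdigraph.
DichromaticAtMost : Digraph → ℕ → Set
DichromaticAtMost D k =
  Σ (Fin (n D) → Fin k) λ c → ∀ (a : Fin k) → Acyclic D (λ v → c v ≡ a)

-- A total ordering of V(D) = Fin n, given by a permutation σ (σ v is the
-- position of v); x precedes y iff σ x < σ y.
Ordering : Digraph → Set
Ordering D = Permutation′ (n D)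

Precedes : (D : Digraph) → Ordering D → Fin (n D) → Fin (n D) → Set
Precedes D σ x y = toℕ (σ ⟨$⟩ʳ x) < toℕ (σ ⟨$⟩ʳ y)

Backward : (D : Digraph) → Ordering D → Fin (n D) → Fin (n D) → Set
Backward D σ x y = T (Arc D x y) × Precedes D σ y x

record BackwardPath (D : Digraph) (σ : Ordering D) (p : ℕ) : Set where
  field
    vtx      : Fin p → Fin (n D)
    distinct : Injective _≡_ _≡_ vtx
    arcs     : ∀ (i j : Fin p) → toℕ j ≡ suc (toℕ i) →
               Backward D σ (vtx i) (vtx j)

-- (i) ⇒ (ii): order the vertices by colour, and inside a colour class
-- topologically, by decreasing length of the longest monochromatic path
-- starting at the vertex.  Then every backward arc decreases the colour, so
-- the colours along a backward path are distinct and a backward path has at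
-- most k vertices.
-- (ii) ⇒ (i): colour a vertex by the number of vertices of the longest
-- backward path starting at it, which lies in 1 … k.  A backward arc strictly
-- decreases this number, so every colour class contains only forward arcs
-- and is therefore acyclic.
module Submission where

open import Defs
open import Data.Nat using (ℕ; zero; suc; _≤_; _<_; _>_; _+_; _*_; _∸_; _⊔_; z≤n; s≤s; z<s)
open import Data.Nat.Properties
open import Data.Fin as Fin using (Fin; toℕ; fromℕ<; inject≤; punchOut)
import Data.Fin.Properties as Finₚ
open import Data.Fin.Subset using (Subset; _∈_; _∉_; ∣_∣)
open import Data.Fin.Subset.Properties using (∈⊤; ∣⊤∣≡n; p⊂q⇒∣p∣<∣q∣)
open import Data.Fin.Permutation using (Permutation′; permutation; _⟨$⟩ʳ_; _⟨$⟩ˡ_; inverseˡ)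
open import Data.Vec using (tabulate)
open import Data.Vec.Properties using (lookup∘tabulate; []=⇒lookup; lookup⇒[]=)
open import Data.Vec.Functional using (Vector; []; _∷_)
open import Data.Bool using (T; if_then_else_)
open import Data.Product using (Σ; ∃; _×_; _,_; proj₁; proj₂)
open import Data.Sum using (_⊎_; inj₁; inj₂)
open import Data.Empty using (⊥-elim)
open import Function using (_∘_; flip)
open import Function.Bundles using (_⇔_; mk⇔)
open import Function.Definitions using (Injective)
open import Relation.Binary using (Rel; Transitive; Irreflexive; tri<; tri≈; tri>)
open import Relation.Binary.PropositionalEquality
open import Relation.Nullary using (¬_; Dec; yes; no; does; _×-dec_; contradiction)
open import Relation.Nullary.Decidable using (T?; dec-true; dec-false)

module _ {a ℓ} {A : Set a} (_≺_ : Rel A ℓ) where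

  Chain : ∀ {L} → (Fin L → A) → Set ℓ
  Chain g = ∀ i j → toℕ j ≡ suc (toℕ i) → g i ≺ g j

  chain-tail : ∀ {L} {g : Fin (suc L) → A} → Chain g → Chain (g ∘ Fin.suc)
  chain-tail ch i j eq = ch (Fin.suc i) (Fin.suc j) (cong suc eq)

  chain⇒related : Transitive _≺_ → ∀ {L} (g : Fin L → A) → Chain g →
                  ∀ {i j} → toℕ i < toℕ j → g i ≺ g j
  chain⇒related trans g ch {Fin.zero} {Fin.suc Fin.zero} _ = ch Fin.zero (Fin.suc Fin.zero) refl
  chain⇒related trans g ch {Fin.zero} {Fin.suc (Fin.suc j)} _ =
    trans (ch Fin.zero (Fin.suc Fin.zero) refl) (chain⇒related trans (g ∘ Fin.suc) (chain-tail ch) z<s)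
  chain⇒related trans g ch {Fin.suc i} {Fin.suc j} (s≤s i<j) =
    chain⇒related trans (g ∘ Fin.suc) (chain-tail ch) i<j

  chain⇒injective : Transitive _≺_ → Irreflexive _≡_ _≺_ → ∀ {L} (g : Fin L → A) → Chain g →
                    Injective _≡_ _≡_ g
  chain⇒injective trans irrefl g ch {i} {j} gi≡gj with <-cmp (toℕ i) (toℕ j)
  ... | tri< i<j _ _ = ⊥-elim (irrefl gi≡gj (chain⇒related trans g ch i<j))
  ... | tri≈ _ i≡j _ = Finₚ.toℕ-injective i≡j
  ... | tri> _ _ j<i = ⊥-elim (irrefl (sym gi≡gj) (chain⇒related trans g ch j<i))

∷-injective-fresh : ∀ {A : Set} {m} {x : A} {f : Vector A m} →
                    Injective _≡_ _≡_ f → (∀ i → f i ≢ x) → Injective _≡_ _≡_ (x ∷ f)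
∷-injective-fresh f-inj x∉f {Fin.zero}  {Fin.zero}  _   = refl
∷-injective-fresh f-inj x∉f {Fin.zero}  {Fin.suc j} eq  = ⊥-elim (x∉f j (sym eq))
∷-injective-fresh f-inj x∉f {Fin.suc i} {Fin.zero}  eq  = ⊥-elim (x∉f i eq)
∷-injective-fresh f-inj x∉f {Fin.suc i} {Fin.suc j} eq  = cong Fin.suc (f-inj eq)

maxᶠ : ∀ {n} → (Fin n → ℕ) → ℕ
maxᶠ {zero}  g = 0
maxᶠ {suc n} g = g Fin.zero ⊔ maxᶠ (g ∘ Fin.suc)

maxᶠ-upper : ∀ {n} (g : Fin n → ℕ) i → g i ≤ maxᶠ g
maxᶠ-upper g Fin.zero    = m≤m⊔n _ _
maxᶠ-upper g (Fin.suc i) = ≤-trans (maxᶠ-upper (g ∘ Fin.suc) i) (m≤n⊔m _ _)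

maxᶠ-least : ∀ {n} (g : Fin n → ℕ) {b} → (∀ i → g i ≤ b) → maxᶠ g ≤ b
maxᶠ-least {zero}  g g≤b = z≤n
maxᶠ-least {suc n} g g≤b = ⊔-lub (g≤b Fin.zero) (maxᶠ-least (g ∘ Fin.suc) (g≤b ∘ Fin.suc))

maxᶠ-witness : ∀ {n} (g : Fin n → ℕ) {m} → 0 < m → m ≤ maxᶠ g → ∃ λ i → m ≤ g i
maxᶠ-witness {zero}  g 0<m m≤0 = ⊥-elim (<⇒≱ 0<m m≤0)
maxᶠ-witness {suc n} g 0<m m≤max with ⊔-sel (g Fin.zero) (maxᶠ (g ∘ Fin.suc))
... | inj₁ max≡g₀ = Fin.zero , subst (_ ≤_) max≡g₀ m≤max
... | inj₂ max≡rest =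
  let i , m≤gᵢ = maxᶠ-witness (g ∘ Fin.suc) 0<m (subst (_ ≤_) max≡rest m≤max) in Fin.suc i , m≤gᵢ

guard : ∀ {p} {P : Set p} → Dec P → ℕ → ℕ
guard d x = if does d then x else 0

guard-≤ : ∀ {p} {P : Set p} (d : Dec P) {x} → guard d x ≤ x
guard-≤ (yes _) = ≤-refl
guard-≤ (no _)  = z≤n

guard-yes : ∀ {p} {P : Set p} (d : Dec P) {x} → P → guard d x ≡ x
guard-yes (yes _) _  = refl
guard-yes (no ¬p) p  = ⊥-elim (¬p p)

guard-pos : ∀ {p} {P : Set p} (d : Dec P) {x m} → 0 < m → m ≤ guard d x → P × m ≤ x
guard-pos (yes p) _   m≤x = p , m≤x
guard-pos (no _)  0<m m≤0 = ⊥-elim (<⇒≱ 0<m m≤0)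

*+-lex-< : ∀ {a b r s N} → a < b → r < N → a * N + r < b * N + s
*+-lex-< {a} {b} {r} {s} {N} a<b r<N = begin-strict
  a * N + r  <⟨ +-monoʳ-< (a * N) r<N ⟩
  a * N + N  ≡⟨ +-comm (a * N) N ⟩
  suc a * N  ≤⟨ *-monoˡ-≤ N a<b ⟩
  b * N      ≤⟨ m≤m+n (b * N) s ⟩
  b * N + s  ∎
  where open ≤-Reasoning

*+-remainder-unique : ∀ {a b r s N} → r < N → s < N → a * N + r ≡ b * N + s → r ≡ s
*+-remainder-unique {a} {b} {r} {s} {N} r<N s<N eq with <-cmp a b
... | tri< a<b _ _ = ⊥-elim (<⇒≢ (*+-lex-< a<b r<N) eq)
... | tri≈ _ refl _ = +-cancelˡ-≡ (a * N) r s eq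
... | tri> _ _ b<a = ⊥-elim (<⇒≢ (*+-lex-< b<a s<N) (sym eq))

injective⇒surjective : ∀ {n} (f : Fin n → Fin n) → Injective _≡_ _≡_ f → ∀ y → ∃ λ x → f x ≡ y
injective⇒surjective {suc n} f f-inj y with Finₚ.any? (λ x → f x Finₚ.≟ y)
... | yes hit = hit
... | no miss = ⊥-elim (1+n≰n (Finₚ.injective⇒≤ g-inj))
  where
  g : Fin (suc n) → Fin n
  g x = punchOut {i = y} {j = f x} (λ y≡fx → miss (x , sym y≡fx))
  g-inj : Injective _≡_ _≡_ g
  g-inj {x} {x′} eq =
    f-inj (Finₚ.punchOut-injective (λ e → miss (x , sym e)) (λ e → miss (x′ , sym e)) eq)

module _ {n} (κ : Fin n → ℕ) (κ-injective : Injective _≡_ _≡_ κ) where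

  private
    below : Fin n → Subset n
    below x = tabulate λ w → does (κ w <? κ x)

    below⁺ : ∀ {w x} → κ w < κ x → w ∈ below x
    below⁺ {w} {x} κw<κx =
      lookup⇒[]= w (below x) (trans (lookup∘tabulate _ w) (dec-true (κ w <? κ x) κw<κx))

    below⁻ : ∀ {w x} → w ∈ below x → κ w < κ x
    below⁻ {w} {x} w∈ with κ w <? κ x
    ... | yes κw<κx = κw<κx
    ... | no κw≮κx =
      contradiction (trans (sym (dec-false (κ w <? κ x) κw≮κx))
                           (trans (sym (lookup∘tabulate _ w)) ([]=⇒lookup w∈))) λ ()

    below-irrefl : ∀ {x} → x ∉ below x
    below-irrefl = <-irrefl refl ∘ below⁻

    rank<n : ∀ x → ∣ below x ∣ < n
    rank<n x = subst (∣ below x ∣ <_) (∣⊤∣≡n n) (p⊂q⇒∣p∣<∣q∣ ((λ _ → ∈⊤) , x , ∈⊤ , below-irrefl))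

    position : Fin n → Fin n
    position x = fromℕ< (rank<n x)

    position-monotone : ∀ {x y} → κ x < κ y → toℕ (position x) < toℕ (position y)
    position-monotone {x} {y} κx<κy =
      subst₂ _<_ (sym (Finₚ.toℕ-fromℕ< (rank<n x))) (sym (Finₚ.toℕ-fromℕ< (rank<n y)))
        (p⊂q⇒∣p∣<∣q∣ ((λ w∈ → below⁺ (<-trans (below⁻ w∈) κx<κy)) , x , below⁺ κx<κy , below-irrefl))

    position-injective : Injective _≡_ _≡_ position
    position-injective {x} {y} eq with <-cmp (κ x) (κ y)
    ... | tri< κx<κy _ _ = ⊥-elim (<⇒≢ (position-monotone κx<κy) (cong toℕ eq))
    ... | tri≈ _ κx≡κy _ = κ-injective κx≡κy
    ... | tri> _ _ κy<κx = ⊥-elim (<⇒≢ (position-monotone κy<κx) (cong toℕ (sym eq)))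

  orderingBy : Σ (Permutation′ n) λ σ → ∀ {x y} → κ x < κ y → toℕ (σ ⟨$⟩ʳ x) < toℕ (σ ⟨$⟩ʳ y)
  orderingBy = permutation position (proj₁ ∘ surjective) (proj₂ ∘ surjective)
                 (λ x → position-injective (proj₂ (surjective (position x))))
             , position-monotone
    where surjective = injective⇒surjective position position-injective

module Walks {n} (_⟶_ : Fin n → Fin n → Set) (_⟶?_ : ∀ u v → Dec (u ⟶ v)) where

  infixr 5 _◅_
  data Walk : Fin n → ℕ → Set where
    [_] : ∀ v → Walk v 1
    _◅_ : ∀ {u v m} → u ⟶ v → Walk v m → Walk u (suc m)

  vertices : ∀ {v m} → Walk v m → Vector (Fin n) m
  vertices [ v ]          = v ∷ []
  vertices (_◅_ {u} _ w)  = u ∷ vertices w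

  vertices-head : ∀ {v m} (w : Walk v m) i → toℕ i ≡ 0 → vertices w i ≡ v
  vertices-head [ v ]   Fin.zero _ = refl
  vertices-head (_ ◅ _) Fin.zero _ = refl

  vertices-chain : ∀ {v m} (w : Walk v m) → Chain _⟶_ (vertices w)
  vertices-chain [ v ]   Fin.zero    Fin.zero    ()
  vertices-chain (e ◅ w) Fin.zero    (Fin.suc j) eq =
    subst (_ ⟶_) (sym (vertices-head w j (suc-injective eq))) e
  vertices-chain (e ◅ w) (Fin.suc i) (Fin.suc j) eq = vertices-chain w i j (suc-injective eq)

  height : ℕ → Fin n → ℕ
  height zero    v = 0
  height (suc f) v = suc (maxᶠ λ u → guard (v ⟶? u) (height f u))

  height-≤ : ∀ f v → height f v ≤ f
  height-≤ zero    v = z≤n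
  height-≤ (suc f) v = s≤s (maxᶠ-least _ λ u → ≤-trans (guard-≤ (v ⟶? u)) (height-≤ f u))

  walk⇒≤height : ∀ {v m f} → Walk v m → m ≤ f → m ≤ height f v
  walk⇒≤height [ v ] (s≤s _) = s≤s z≤n
  walk⇒≤height {f = suc f} (_◅_ {u} {v} {m} e w) (s≤s m≤f) = s≤s (begin
    m                                                ≤⟨ walk⇒≤height w m≤f ⟩
    height f v                                       ≡⟨ guard-yes (u ⟶? v) e ⟨
    guard (u ⟶? v) (height f v)                      ≤⟨ maxᶠ-upper (λ x → guard (u ⟶? x) (height f x)) v ⟩
    maxᶠ (λ x → guard (u ⟶? x) (height f x))         ∎)
    where open ≤-Reasoning

  ≤height⇒walk : ∀ f v {m} → 0 < m → m ≤ height f v → Walk v m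
  ≤height⇒walk zero    v {suc _}         _ ()
  ≤height⇒walk (suc f) v {suc zero}      _ _ = [ v ]
  ≤height⇒walk (suc f) v {suc (suc m)}   _ (s≤s m<max) =
    let u , m<through = maxᶠ-witness _ z<s m<max
        e , m<height  = guard-pos (v ⟶? u) z<s m<through
    in  e ◅ ≤height⇒walk f u z<s m<height

  Bounded : ℕ → Set
  Bounded f = ∀ {v m} → Walk v m → m ≤ f

  module _ {f} (bounded : Bounded f) where

    height-pos : ∀ v → 0 < height f v
    height-pos v = walk⇒≤height [ v ] (bounded [ v ])

    height-decreasing : ∀ {u v} → u ⟶ v → height f v < height f u
    height-decreasing {u} {v} e = walk⇒≤height longer (bounded longer)
      where
      longer : Walk u (suc (height f v))
      longer = e ◅ ≤height⇒walk f v (height-pos v) ≤-refl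

no-self-arc : ∀ D x → ¬ T (Arc D x x)
no-self-arc D x = subst T (noLoop D x)

module ColouringToOrdering (D : Digraph) {k} (c : Fin (n D) → Fin k)
                           (acyclic : ∀ a → Acyclic D (λ v → c v ≡ a)) where

  SameColourArc : Fin (n D) → Fin (n D) → Set
  SameColourArc x y = T (Arc D x y) × c x ≡ c y

  open Walks SameColourArc (λ x y → T? (Arc D x y) ×-dec (c x Finₚ.≟ c y))

  walk-colour : ∀ {v m} (w : Walk v m) i → c (vertices w i) ≡ c v
  walk-colour [ v ]   Fin.zero    = refl
  walk-colour (_ ◅ _) Fin.zero    = refl
  walk-colour (e ◅ w) (Fin.suc i) = trans (walk-colour w i) (sym (proj₂ e))

  closedWalk⇒cycle : ∀ {v m} (w : Walk v m) → Injective _≡_ _≡_ (vertices w) →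
                     ∀ j → T (Arc D (vertices w j) v) → CycleIn D (λ x → c x ≡ c v)
  closedWalk⇒cycle {v} {m} w w-injective j closing = record
    { len = suc (toℕ j) ; len≥2 = s≤s 1≤j ; vtx = vtx
    ; distinct = λ eq → Finₚ.inject≤-injective j<m j<m _ _ (w-injective eq)
    ; inS = λ s → walk-colour w (inject≤ s j<m) ; arcs = arcs }
    where
    j<m : suc (toℕ j) ≤ m
    j<m = Finₚ.toℕ<n j
    vtx : Fin (suc (toℕ j)) → Fin (n D)
    vtx s = vertices w (inject≤ s j<m)
    1≤j : 1 ≤ toℕ j
    1≤j = n≢0⇒n>0 λ j≡0 → no-self-arc D v (subst (λ x → T (Arc D x v)) (vertices-head w j j≡0) closing)
    arcs : ∀ s s′ → toℕ s′ ≡ suc (toℕ s) ⊎ (toℕ s ≡ toℕ j × toℕ s′ ≡ 0) → T (Arc D (vtx s) (vtx s′))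
    arcs s s′ (inj₁ step) = proj₁ (vertices-chain w _ _
      (trans (Finₚ.toℕ-inject≤ s′ j<m) (trans step (cong suc (sym (Finₚ.toℕ-inject≤ s j<m))))))
    arcs s s′ (inj₂ (s-last , s′-first)) = subst₂ (λ x y → T (Arc D x y))
      (cong (vertices w) (Finₚ.toℕ-injective (sym (trans (Finₚ.toℕ-inject≤ s j<m) s-last))))
      (sym (vertices-head w _ (trans (Finₚ.toℕ-inject≤ s′ j<m) s′-first)))
      closing

  walk-injective : ∀ {v m} (w : Walk v m) → Injective _≡_ _≡_ (vertices w)
  walk-injective [ v ] {Fin.zero} {Fin.zero} _ = refl
  walk-injective (_◅_ {u} {v} e w) with Finₚ.any? (λ i → vertices w i Finₚ.≟ u)
  ... | yes (i , wᵢ≡u) = ⊥-elim (acyclic (c v)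
          (closedWalk⇒cycle w (walk-injective w) i (subst (λ x → T (Arc D x v)) (sym wᵢ≡u) (proj₁ e))))
  ... | no u∉w = ∷-injective-fresh (walk-injective w) (λ i wᵢ≡u → u∉w (i , wᵢ≡u))

  depth : Fin (n D) → ℕ
  depth = height (n D)

  depth-decreasing : ∀ {x y} → SameColourArc x y → depth y < depth x
  depth-decreasing = height-decreasing (λ w → Finₚ.injective⇒≤ (walk-injective w))

  -- Sort by colour, then by decreasing depth (which drops along monochromatic arcs), then by index.
  level : Fin (n D) → ℕ
  level v = toℕ (c v) * suc (n D) + (n D ∸ depth v)

  key : Fin (n D) → ℕ
  key v = level v * n D + toℕ v

  key-injective : Injective _≡_ _≡_ key
  key-injective {x} {y} eq =
    Finₚ.toℕ-injective (*+-remainder-unique {level x} {level y} (Finₚ.toℕ<n x) (Finₚ.toℕ<n y) eq)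

  level⇒key< : ∀ {x y} → level x < level y → key x < key y
  level⇒key< {x} {y} lt = *+-lex-< {level x} {level y} lt (Finₚ.toℕ<n x)

  colour⇒key< : ∀ {x y} → c x Fin.< c y → key x < key y
  colour⇒key< {x} cx<cy = level⇒key< (*+-lex-< cx<cy (s≤s (m∸n≤m (n D) (depth x))))

  sameColourArc⇒key< : ∀ {x y} → SameColourArc x y → key x < key y
  sameColourArc⇒key< {x} {y} xy@(_ , cx≡cy) = level⇒key< (begin-strict
    toℕ (c x) * suc (n D) + (n D ∸ depth x)  <⟨ +-monoʳ-< _ (∸-monoʳ-< (depth-decreasing xy) (height-≤ (n D) x)) ⟩
    toℕ (c x) * suc (n D) + (n D ∸ depth y)  ≡⟨ cong (λ a → toℕ a * suc (n D) + (n D ∸ depth y)) cx≡cy ⟩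
    toℕ (c y) * suc (n D) + (n D ∸ depth y)  ∎)
    where open ≤-Reasoning

  σ : Ordering D
  σ = proj₁ (orderingBy key key-injective)

  key⇒precedes : ∀ {x y} → key x < key y → Precedes D σ x y
  key⇒precedes = proj₂ (orderingBy key key-injective)

  backward⇒colour> : ∀ {x y} → Backward D σ x y → c y Fin.< c x
  backward⇒colour> {x} {y} (arc , y≺x) with Finₚ.<-cmp (c x) (c y)
  ... | tri< cx<cy _ _ = ⊥-elim (<-asym y≺x (key⇒precedes (colour⇒key< cx<cy)))
  ... | tri≈ _ cx≡cy _ = ⊥-elim (<-asym y≺x (key⇒precedes (sameColourArc⇒key< (arc , cx≡cy))))
  ... | tri> _ _ cy<cx = cy<cx

  no-backward-path : ¬ BackwardPath D σ (suc k)
  no-backward-path P = 1+n≰n (Finₚ.injective⇒≤ colours-distinct)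
    where
    open BackwardPath P
    colours-distinct : Injective _≡_ _≡_ (c ∘ vtx)
    colours-distinct = chain⇒injective (flip Fin._<_) (flip Finₚ.<-trans) (λ eq → Finₚ.<-irrefl (sym eq))
                         (c ∘ vtx) (λ i j eq → backward⇒colour> (arcs i j eq))

module OrderingToColouring (D : Digraph) (σ : Ordering D) {k}
                           (no-backward-path : ¬ BackwardPath D σ (suc k)) where

  pos : Fin (n D) → ℕ
  pos v = toℕ (σ ⟨$⟩ʳ v)

  pos-injective : Injective _≡_ _≡_ pos
  pos-injective {x} {y} eq =
    trans (sym (inverseˡ σ)) (trans (cong (σ ⟨$⟩ˡ_) (Finₚ.toℕ-injective eq)) (inverseˡ σ))

  open Walks (Backward D σ) (λ x y → T? (Arc D x y) ×-dec (pos y <? pos x))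

  walk⇒backwardPath : ∀ {v m} → Walk v m → BackwardPath D σ m
  walk⇒backwardPath w = record
    { vtx = vertices w
    ; distinct = λ eq → pos-distinct (cong pos eq)
    ; arcs = vertices-chain w }
    where
    pos-distinct : Injective _≡_ _≡_ (pos ∘ vertices w)
    pos-distinct = chain⇒injective _>_ (flip <-trans) (λ eq → <-irrefl (sym eq))
                     (pos ∘ vertices w) (λ i j eq → proj₂ (vertices-chain w i j eq))

  walks-bounded : Bounded (n D)
  walks-bounded w = Finₚ.injective⇒≤ (BackwardPath.distinct (walk⇒backwardPath w))

  depth : Fin (n D) → ℕ
  depth = height (n D)

  depth≤k : ∀ v → depth v ≤ k
  depth≤k v = ≮⇒≥ λ k<depth → no-backward-path (walk⇒backwardPath (≤height⇒walk (n D) v z<s k<depth))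

  colour : Fin (n D) → Fin k
  colour v = fromℕ< {depth v ∸ 1} (<-≤-trans (∸-monoʳ-< z<s (height-pos walks-bounded v)) (depth≤k v))

  backward⇒colour> : ∀ {x y} → Backward D σ x y → colour y Fin.< colour x
  backward⇒colour> {x} {y} xy = subst₂ _<_ (sym (Finₚ.toℕ-fromℕ< _)) (sym (Finₚ.toℕ-fromℕ< _))
    (∸-monoˡ-< (height-decreasing walks-bounded xy) (height-pos walks-bounded y))

  sameColour⇒precedes : ∀ {x y} → colour x ≡ colour y → T (Arc D x y) → Precedes D σ x y
  sameColour⇒precedes {x} {y} same arc with <-cmp (pos x) (pos y)
  ... | tri< x≺y _ _ = x≺y
  ... | tri≈ _ eq _  = ⊥-elim (no-self-arc D y (subst (λ z → T (Arc D z y)) (pos-injective eq) arc))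
  ... | tri> _ _ y≺x = ⊥-elim (Finₚ.<-irrefl (sym same) (backward⇒colour> (arc , y≺x)))

  colour-classes-acyclic : ∀ a → Acyclic D (λ v → colour v ≡ a)
  colour-classes-acyclic a C = <-asym first≺last last≺first
    where
    open CycleIn C
    forward : Chain _<_ (pos ∘ vtx)
    forward i j eq = sameColour⇒precedes (trans (inS i) (sym (inS j))) (arcs i j (inj₁ eq))
    0<len : 0 < len
    0<len = <-trans z<s len≥2
    first last : Fin len
    first = fromℕ< 0<len
    last  = fromℕ< (∸-monoʳ-< z<s 0<len)
    first≺last : pos (vtx first) < pos (vtx last)
    first≺last = chain⇒related _<_ <-trans (pos ∘ vtx) forward
      (subst₂ _<_ (sym (Finₚ.toℕ-fromℕ< _)) (sym (Finₚ.toℕ-fromℕ< _)) (m<n⇒0<n∸m len≥2))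
    last≺first : pos (vtx last) < pos (vtx first)
    last≺first = sameColour⇒precedes (trans (inS last) (sym (inS first)))
      (arcs last first (inj₂ (Finₚ.toℕ-fromℕ< _ , Finₚ.toℕ-fromℕ< _)))

  colouring : DichromaticAtMost D k
  colouring = colour , colour-classes-acyclic

proposition3p3 : (D : Digraph) (k : ℕ) → 1 ≤ k →
    (DichromaticAtMost D k ⇔ Σ (Ordering D) (λ σ → ¬ BackwardPath D σ (suc k)))
proposition3p3 D k _ = mk⇔
  (λ (c , acyclic) → let open ColouringToOrdering D c acyclic in σ , no-backward-path)
  (λ (σ , no-backward-path) → OrderingToColouring.colouring D σ no-backward-path)
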